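{- Let $c$ be a well-formed GCL command, $f$ a label with $\mathsf{okf}(c,f)$, and $P,Q$ sets of stores. If $\models c:\{P\}\{Q\}$, then $c:\{P\}\{Q\}$ is derivable in HL+.
   Context: Stores are total maps from integer variables to $\mathbb{Z}$. GCL commands: $c ::= \mathsf{skip}^n \mid x :=^n e \mid c;c \mid \mathsf{if}^n\, gcs\,\mathsf{fi} \mid \mathsf{do}^n\, gcs\,\mathsf{od}$, $gcs ::= e\to c \mid e\to c\,\square\,gcs$, integer labels $n$, always-defined expressions, boolean expressions from primitive ones via $\wedge,\vee,\neg$; $\mathsf{enab}(gcs)$ the disjunction of guards; well formed: well typed and each $\mathsf{if}^n gcs\,\mathsf{fi}$ has $\mathsf{enab}(gcs)$ true in every store. $\mathsf{labs}(c)$: labels occurring in $c$; $\mathsf{okf}(c,f)$: labels of $c$ positive and pairwise distinct, $f\notin\mathsf{labs}(c)$. $[\![c]\!]$: standard big-step partial-correctness relation (identity for skip; update for assignment; composition; if picks any enabled branch; do iterates enabled branches until $\mathsf{enab}(gcs)$ false). $\models c:\{P\}\{Q\}$: $(s,t)\in[\![c]\!]$ and $s\in P$ imply $t\in Q$. Assertions are sets of stores (boolean expressions denote the stores where they hold), $s\in P[x:=e]$ iff $s[x\mapsto[\![e]\!](s)]\in P$, $\mathrm{indep}(x,P)$: membership in $P$ independent of $x$; $\mathsf{ghost}(x,c)$: $x$ occurs in $c$ only in assignments to $x$; $\mathsf{erase}(x,c)$: assignments to $x$ replaced by skip. $c\cong d$ means $\mathrm{Hyp}\vdash\mathcal{K}(c)=\mathcal{K}(d)$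 in Kleene algebra with tests, with translation $\mathcal{K}(\mathsf{skip})=1$, $\mathcal{K}(x:=e)=\underline{x:=e}$, $\mathcal{K}(c;d)=\mathcal{K}(c);\mathcal{K}(d)$, $\mathcal{K}(\mathsf{if}\,gcs\,\mathsf{fi})=\sum_{e\to c\in gcs}\mathcal{K}(e);\mathcal{K}(c)$, $\mathcal{K}(\mathsf{do}\,gcs\,\mathsf{od})=(\sum_{e\to c\in gcs}\mathcal{K}(e);\mathcal{K}(c))^*;\neg\mathcal{K}(\mathsf{enab}(gcs))$, boolean connectives to test operations, and $\mathrm{Hyp}$ = equations $\mathcal{K}(e)=0$ for unsatisfiable boolean $e$ and $\mathcal{K}(e_0);\underline{x:=e};\neg\mathcal{K}(e_1)=0$ whenever $e_0\Rightarrow e_1[x:=e]$ is valid. HL+ rules: Rewrite (from $c:\{P\}\{Q\}$ and $c\cong d$ infer $d:\{P\}\{Q\}$); Ghost (from $c:\{P\}\{Q\}$, $\mathsf{ghost}(x,c)$, $\mathrm{indep}(x,P)$, $\mathrm{indep}(x,Q)$ infer $\mathsf{erase}(x,c):\{P\}\{Q\}$); Do (from $c:\{e\wedge P\}\{P\}$ for all $e\to c\in gcs$ infer $\mathsf{do}\,gcs\,\mathsf{od}:\{P\}\{P\wedge\neg\mathsf{enab}(gcs)\}$); Asgn ($x:=e:\{P[x:=e]\}\{P\}$); Skip ($\mathsf{skip}:\{P\}\{P\}$); Seq (from $c:\{P\}\{R\}$, $d:\{R\}\{Q\}$ infer $c;d:\{P\}\{Q\}$); If (from $c:\{e\wedge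 P\}\{Q\}$ for all $e\to c\in gcs$ infer $\mathsf{if}\,gcs\,\mathsf{fi}:\{P\}\{Q\}$); Conseq (from $P\subseteq R$, $c:\{R\}\{S\}$, $S\subseteq Q$ infer $c:\{P\}\{Q\}$); False ($c:\{\mathrm{false}\}\{P\}$). -}

module Defs where

open import Data.Nat using (ℕ; _≟_)
open import Data.Integer as ℤ using (ℤ; +_; _>_)
open import Data.Integer.Properties using (_≤?_)
import Data.Integer.Properties as ℤP
open import Data.Bool using (Bool; true; false; _∧_; _∨_; not; T; if_then_else_)
open import Data.List using (List; []; _∷_; _++_)
open import Data.List.Relation.Unary.All using (All)
open import Data.List.Relation.Unary.Unique.Propositional using (Unique)
open import Data.List.Membership.Propositional using (_∉_)
open import Data.Product using (_×_; _,_; Σ; ∃)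
open import Data.Sum using (_⊎_)
open import Data.Empty using (⊥)
open import Data.Unit using (⊤)
open import Relation.Nullary using (¬_; does)
open import Relation.Binary.PropositionalEquality using (_≡_)

Var : Set
Var = ℕ

Label : Set
Label = ℤ

Store : Set
Store = Var → ℤ

_[_↦_] : Store → Var → ℤ → Store
(s [ x ↦ v ]) y = if does (y ≟ x) then v else s y

-- Expressions (always defined; well-typedness is enforced by the
-- separation into integer and boolean syntax)

data IExp : Set where
  lit  : ℤ → IExp
  var  : Var → IExp
  plus minus times : IExp → IExp → IExp

data PrimB : Set where
  eqP leP : IExp → IExp → PrimB

data BExp : Set where
  prim  : PrimB → BExp
  btrue bfalse : BExp
  band bor : BExp → BExp → BExp
  bnot  : BExp → BExp

evalI : IExp → Store → ℤ
evalI (lit n) s = n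
evalI (var x) s = s x
evalI (plus a b) s = evalI a s ℤ.+ evalI b s
evalI (minus a b) s = evalI a s ℤ.- evalI b s
evalI (times a b) s = evalI a s ℤ.* evalI b s

evalP : PrimB → Store → Bool
evalP (eqP a b) s = does (evalI a s ℤP.≟ evalI b s)
evalP (leP a b) s = does (evalI a s ≤? evalI b s)

evalB : BExp → Store → Bool
evalB (prim p) s = evalP p s
evalB btrue s = true
evalB bfalse s = false
evalB (band a b) s = evalB a s ∧ evalB b s
evalB (bor a b) s = evalB a s ∨ evalB b s
evalB (bnot a) s = not (evalB a s)

substI : IExp → Var → IExp → IExp
substI (lit n) x e = lit n
substI (var y) x e = if does (y ≟ x) then e else var y
substI (plus a b) x e = plus (substI a x e) (substI b x e)
substI (minus a b) x e = minus (substI a x e) (substI b x e)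
substI (times a b) x e = times (substI a x e) (substI b x e)

substP : PrimB → Var → IExp → PrimB
substP (eqP a b) x e = eqP (substI a x e) (substI b x e)
substP (leP a b) x e = leP (substI a x e) (substI b x e)

substB : BExp → Var → IExp → BExp
substB (prim p) x e = prim (substP p x e)
substB btrue x e = btrue
substB bfalse x e = bfalse
substB (band a b) x e = band (substB a x e) (substB b x e)
substB (bor a b) x e = bor (substB a x e) (substB b x e)
substB (bnot a) x e = bnot (substB a x e)

data OccI (x : Var) : IExp → Set where
  here : OccI x (var x)
  plusˡ  : ∀ {a b} → OccI x a → OccI x (plus a b)
  plusʳ  : ∀ {a b} → OccI x b → OccI x (plus a b)
  minusˡ : ∀ {a b} → OccI x a → OccI x (minus a b)
  minusʳ : ∀ {a b} → OccI x b → OccI x (minus a b)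
  timesˡ : ∀ {a b} → OccI x a → OccI x (times a b)
  timesʳ : ∀ {a b} → OccI x b → OccI x (times a b)

OccP : Var → PrimB → Set
OccP x (eqP a b) = OccI x a ⊎ OccI x b
OccP x (leP a b) = OccI x a ⊎ OccI x b

OccB : Var → BExp → Set
OccB x (prim p) = OccP x p
OccB x btrue = ⊥
OccB x bfalse = ⊥
OccB x (band a b) = OccB x a ⊎ OccB x b
OccB x (bor a b) = OccB x a ⊎ OccB x b
OccB x (bnot a) = OccB x a

mutual
  data Cmd : Set where
    skip : Label → Cmd
    asgn : Label → Var → IExp → Cmd
    _⨾_  : Cmd → Cmd → Cmd
    ifc  : Label → GCs → Cmd
    doc  : Label → GCs → Cmd

  data GCs : Set where
    [_⇒_]    : BExp → Cmd → GCs
    _⇒_□_    : BExp → Cmd → GCs → GCs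

data _⇒_∈GC_ (e : BExp) (c : Cmd) : GCs → Set where
  here₁ : e ⇒ c ∈GC [ e ⇒ c ]
  here  : ∀ {g} → e ⇒ c ∈GC (e ⇒ c □ g)
  there : ∀ {e′ c′ g} → e ⇒ c ∈GC g → e ⇒ c ∈GC (e′ ⇒ c′ □ g)

enab : GCs → BExp
enab [ e ⇒ c ] = e
enab (e ⇒ c □ g) = bor e (enab g)

mutual
  labs : Cmd → List Label
  labs (skip n) = n ∷ []
  labs (asgn n x e) = n ∷ []
  labs (c ⨾ d) = labs c ++ labs d
  labs (ifc n g) = n ∷ labsG g
  labs (doc n g) = n ∷ labsG g

  labsG : GCs → List Label
  labsG [ e ⇒ c ] = labs c
  labsG (e ⇒ c □ g) = labs c ++ labsG g

okf : Cmd → Label → Set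
okf c f = All (_> + 0) (labs c) × Unique (labs c) × f ∉ labs c

mutual
  WellFormed : Cmd → Set
  WellFormed (skip n) = ⊤
  WellFormed (asgn n x e) = ⊤
  WellFormed (c ⨾ d) = WellFormed c × WellFormed d
  WellFormed (ifc n g) = (∀ s → T (evalB (enab g) s)) × WellFormedG g
  WellFormed (doc n g) = WellFormedG g

  WellFormedG : GCs → Set
  WellFormedG [ e ⇒ c ] = WellFormed c
  WellFormedG (e ⇒ c □ g) = WellFormed c × WellFormedG g

mutual
  ghost : Var → Cmd → Set
  ghost x (skip n) = ⊤
  ghost x (asgn n y e) = y ≡ x ⊎ ¬ OccI x e
  ghost x (c ⨾ d) = ghost x c × ghost x d
  ghost x (ifc n g) = ghostG x g
  ghost x (doc n g) = ghostG x g

  ghostG : Var → GCs → Set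
  ghostG x [ e ⇒ c ] = ¬ OccB x e × ghost x c
  ghostG x (e ⇒ c □ g) = ¬ OccB x e × ghost x c × ghostG x g

mutual
  erase : Var → Cmd → Cmd
  erase x (skip n) = skip n
  erase x (asgn n y e) = if does (y ≟ x) then skip n else asgn n y e
  erase x (c ⨾ d) = erase x c ⨾ erase x d
  erase x (ifc n g) = ifc n (eraseG x g)
  erase x (doc n g) = doc n (eraseG x g)

  eraseG : Var → GCs → GCs
  eraseG x [ e ⇒ c ] = [ e ⇒ erase x c ]
  eraseG x (e ⇒ c □ g) = e ⇒ erase x c □ eraseG x g

data ⟦_⟧ : Cmd → Store → Store → Set where
  skipE : ∀ {n s} → ⟦ skip n ⟧ s s
  asgnE : ∀ {n x e s} → ⟦ asgn n x e ⟧ s (s [ x ↦ evalI e s ])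
  seqE  : ∀ {c d s u t} → ⟦ c ⟧ s u → ⟦ d ⟧ u t → ⟦ c ⨾ d ⟧ s t
  ifE   : ∀ {n g e c s t} → e ⇒ c ∈GC g → T (evalB e s) → ⟦ c ⟧ s t →
          ⟦ ifc n g ⟧ s t
  doStop : ∀ {n g s} → ¬ T (evalB (enab g) s) → ⟦ doc n g ⟧ s s
  doStep : ∀ {n g e c s u t} → e ⇒ c ∈GC g → T (evalB e s) → ⟦ c ⟧ s u →
           ⟦ doc n g ⟧ u t → ⟦ doc n g ⟧ s t

Assn : Set₁
Assn = Store → Set

_⊆ₐ_ : Assn → Assn → Set
P ⊆ₐ Q = ∀ s → P s → Q s

_[_≔_] : Assn → Var → IExp → Assn
(P [ x ≔ e ]) s = P (s [ x ↦ evalI e s ])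

indep : Var → Assn → Set
indep x P = ∀ s v → (P s → P (s [ x ↦ v ])) × (P (s [ x ↦ v ]) → P s)

_∧ₐ_ : BExp → Assn → Assn
(e ∧ₐ P) s = T (evalB e s) × P s

falseₐ : Assn
falseₐ s = ⊥

⊨_∶⟨_⟩⟨_⟩ : Cmd → Assn → Assn → Set
⊨ c ∶⟨ P ⟩⟨ Q ⟩ = ∀ s t → ⟦ c ⟧ s t → P s → Q t

-- Kleene algebra with tests (two-sorted: tests embedded in KAT terms)

data Test : Set where
  tprim : PrimB → Test
  t0 t1 : Test
  _t·_ _t+_ : Test → Test → Test
  t¬ : Test → Test

data KTerm : Set where
  act  : Var → IExp → KTerm
  test : Test → KTerm
  𝟘 𝟙  : KTerm
  _⊕_ _⊙_ : KTerm → KTerm → KTerm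
  _⋆  : KTerm → KTerm

infixl 6 _⊕_
infixl 7 _⊙_

KT : BExp → Test
KT (prim p) = tprim p
KT btrue = t1
KT bfalse = t0
KT (band a b) = KT a t· KT b
KT (bor a b) = KT a t+ KT b
KT (bnot a) = t¬ (KT a)

KB : BExp → KTerm
KB e = test (KT e)

mutual
  K : Cmd → KTerm
  K (skip n) = 𝟙
  K (asgn n x e) = act x e
  K (c ⨾ d) = K c ⊙ K d
  K (ifc n g) = KG g
  K (doc n g) = (KG g ⋆) ⊙ test (t¬ (KT (enab g)))

  KG : GCs → KTerm
  KG [ e ⇒ c ] = KB e ⊙ K c
  KG (e ⇒ c □ g) = (KB e ⊙ K c) ⊕ KG g

data Hyp : KTerm → KTerm → Set where
  unsat : ∀ e → (∀ s → ¬ T (evalB e s)) → Hyp (KB e) 𝟘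
  asgnH : ∀ e₀ x e e₁ →
          (∀ s → T (evalB e₀ s) → T (evalB (substB e₁ x e) s)) →
          Hyp (KB e₀ ⊙ act x e ⊙ test (t¬ (KT e₁))) 𝟘

infix 4 _≈ₖ_ _≤ₖ_
mutual
  _≤ₖ_ : KTerm → KTerm → Set
  p ≤ₖ q = p ⊕ q ≈ₖ q

  data _≈ₖ_ : KTerm → KTerm → Set where
    hyp   : ∀ {p q} → Hyp p q → p ≈ₖ q
    refl  : ∀ {p} → p ≈ₖ p
    sym   : ∀ {p q} → p ≈ₖ q → q ≈ₖ p
    trans : ∀ {p q r} → p ≈ₖ q → q ≈ₖ r → p ≈ₖ r
    ⊕-cong : ∀ {p p′ q q′} → p ≈ₖ p′ → q ≈ₖ q′ → p ⊕ q ≈ₖ p′ ⊕ q′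
    ⊙-cong : ∀ {p p′ q q′} → p ≈ₖ p′ → q ≈ₖ q′ → p ⊙ q ≈ₖ p′ ⊙ q′
    ⋆-cong : ∀ {p q} → p ≈ₖ q → p ⋆ ≈ₖ q ⋆
    ⊕-assoc : ∀ p q r → (p ⊕ q) ⊕ r ≈ₖ p ⊕ (q ⊕ r)
    ⊕-comm  : ∀ p q → p ⊕ q ≈ₖ q ⊕ p
    ⊕-idem  : ∀ p → p ⊕ p ≈ₖ p
    ⊕-zero  : ∀ p → p ⊕ 𝟘 ≈ₖ p
    ⊙-assoc : ∀ p q r → (p ⊙ q) ⊙ r ≈ₖ p ⊙ (q ⊙ r)
    ⊙-oneˡ  : ∀ p → 𝟙 ⊙ p ≈ₖ p
    ⊙-oneʳ  : ∀ p → p ⊙ 𝟙 ≈ₖ p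
    ⊙-zeroˡ : ∀ p → 𝟘 ⊙ p ≈ₖ 𝟘
    ⊙-zeroʳ : ∀ p → p ⊙ 𝟘 ≈ₖ 𝟘
    distribˡ : ∀ p q r → p ⊙ (q ⊕ r) ≈ₖ (p ⊙ q) ⊕ (p ⊙ r)
    distribʳ : ∀ p q r → (p ⊕ q) ⊙ r ≈ₖ (p ⊙ r) ⊕ (q ⊙ r)
    unfoldˡ : ∀ p → 𝟙 ⊕ p ⊙ (p ⋆) ≤ₖ p ⋆
    unfoldʳ : ∀ p → 𝟙 ⊕ (p ⋆) ⊙ p ≤ₖ p ⋆
    indˡ : ∀ p q r → q ⊕ p ⊙ r ≤ₖ r → (p ⋆) ⊙ q ≤ₖ r
    indʳ : ∀ p q r → q ⊕ r ⊙ p ≤ₖ r → q ⊙ (p ⋆) ≤ₖ r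
    test-0 : test t0 ≈ₖ 𝟘
    test-1 : test t1 ≈ₖ 𝟙
    test-· : ∀ a b → test (a t· b) ≈ₖ test a ⊙ test b
    test-+ : ∀ a b → test (a t+ b) ≈ₖ test a ⊕ test b
    test-comm : ∀ a b → test a ⊙ test b ≈ₖ test b ⊙ test a
    test-idem : ∀ a → test a ⊙ test a ≈ₖ test a
    test-compl⊕ : ∀ a → test a ⊕ test (t¬ a) ≈ₖ 𝟙
    test-compl⊙ : ∀ a → test a ⊙ test (t¬ a) ≈ₖ 𝟘

_≅_ : Cmd → Cmd → Set
c ≅ d = K c ≈ₖ K d

data ⊢_∶⟨_⟩⟨_⟩ : Cmd → Assn → Assn → Set₁ where
  Rewrite : ∀ {c d P Q} → ⊢ c ∶⟨ P ⟩⟨ Q ⟩ → c ≅ d → ⊢ d ∶⟨ P ⟩⟨ Q ⟩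
  Ghost   : ∀ {c P Q} x → ⊢ c ∶⟨ P ⟩⟨ Q ⟩ → ghost x c → indep x P → indep x Q →
            ⊢ erase x c ∶⟨ P ⟩⟨ Q ⟩
  Do      : ∀ {n g P} → (∀ e c → e ⇒ c ∈GC g → ⊢ c ∶⟨ e ∧ₐ P ⟩⟨ P ⟩) →
            ⊢ doc n g ∶⟨ P ⟩⟨ (λ s → P s × ¬ T (evalB (enab g) s)) ⟩
  Asgn    : ∀ {n x e P} → ⊢ asgn n x e ∶⟨ P [ x ≔ e ] ⟩⟨ P ⟩
  Skip    : ∀ {n P} → ⊢ skip n ∶⟨ P ⟩⟨ P ⟩
  Seq     : ∀ {c d P R Q} → ⊢ c ∶⟨ P ⟩⟨ R ⟩ → ⊢ d ∶⟨ R ⟩⟨ Q ⟩ → ⊢ c ⨾ d ∶⟨ P ⟩⟨ Q ⟩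
  If      : ∀ {n g P Q} → (∀ e c → e ⇒ c ∈GC g → ⊢ c ∶⟨ e ∧ₐ P ⟩⟨ Q ⟩) →
            ⊢ ifc n g ∶⟨ P ⟩⟨ Q ⟩
  Conseq  : ∀ {c P R S Q} → P ⊆ₐ R → ⊢ c ∶⟨ R ⟩⟨ S ⟩ → S ⊆ₐ Q → ⊢ c ∶⟨ P ⟩⟨ Q ⟩
  False   : ∀ {c P} → ⊢ c ∶⟨ falseₐ ⟩⟨ P ⟩

{-# OPTIONS --safe #-}
module Submission where

open import Defs
open import Data.Bool using (T)
open import Data.Product using (_×_; _,_)
open import Relation.Nullary using (¬_)

-- Since assertions are arbitrary sets of stores, the weakest liberal
-- precondition wlp c Q is itself an assertion, and the core rules (Skip, Asgn,
-- Seq, If, Do with invariant wlp (do gcs od) Q, Conseq) derive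
-- c : {wlp c Q} {Q} by induction on c.  Validity of c : {P} {Q} says exactly
-- P ⊆ wlp c Q, so one more Conseq finishes.

wlp : Cmd → Assn → Assn
wlp c Q s = ∀ t → ⟦ c ⟧ s t → Q t

strengthen : ∀ {c P R Q} → P ⊆ₐ R → ⊢ c ∶⟨ R ⟩⟨ Q ⟩ → ⊢ c ∶⟨ P ⟩⟨ Q ⟩
strengthen P⊆R ⊢c = Conseq P⊆R ⊢c (λ _ q → q)

⊨⇒⊆wlp : ∀ {c P Q} → ⊨ c ∶⟨ P ⟩⟨ Q ⟩ → P ⊆ₐ wlp c Q
⊨⇒⊆wlp ⊨c s p t c-s-t = ⊨c s t c-s-t p

module _ {Q : Assn} where

  wlp-skip : ∀ {n} → wlp (skip n) Q ⊆ₐ Q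
  wlp-skip s w = w s skipE

  wlp-asgn : ∀ {n x e} → wlp (asgn n x e) Q ⊆ₐ (Q [ x ≔ e ])
  wlp-asgn s w = w _ asgnE

  wlp-seq : ∀ {c d} → wlp (c ⨾ d) Q ⊆ₐ wlp c (wlp d Q)
  wlp-seq s w u c-s-u t d-u-t = w t (seqE c-s-u d-u-t)

  wlp-if : ∀ {n g e c} → e ⇒ c ∈GC g → (e ∧ₐ wlp (ifc n g) Q) ⊆ₐ wlp c Q
  wlp-if e⇒c s (e-s , w) t c-s-t = w t (ifE e⇒c e-s c-s-t)

  wlp-do-step : ∀ {n g e c} → e ⇒ c ∈GC g →
                (e ∧ₐ wlp (doc n g) Q) ⊆ₐ wlp c (wlp (doc n g) Q)
  wlp-do-step e⇒c s (e-s , w) u c-s-u t do-u-t = w t (doStep e⇒c e-s c-s-u do-u-t)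

  wlp-do-exit : ∀ {n g} → (λ s → wlp (doc n g) Q s × ¬ T (evalB (enab g) s)) ⊆ₐ Q
  wlp-do-exit s (w , disabled) = w s (doStop disabled)

mutual
  ⊢wlp : (c : Cmd) (Q : Assn) → ⊢ c ∶⟨ wlp c Q ⟩⟨ Q ⟩
  ⊢wlp (skip n)     Q = strengthen wlp-skip Skip
  ⊢wlp (asgn n x e) Q = strengthen wlp-asgn Asgn
  ⊢wlp (c ⨾ d)      Q = strengthen wlp-seq (Seq (⊢wlp c (wlp d Q)) (⊢wlp d Q))
  ⊢wlp (ifc n g)    Q = If (λ e c e⇒c → strengthen (wlp-if e⇒c) (⊢wlp-branch g e⇒c Q))
  ⊢wlp (doc n g)    Q =
    Conseq (λ _ w → w)
           (Do (λ e c e⇒c →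
             strengthen (wlp-do-step e⇒c) (⊢wlp-branch g e⇒c (wlp (doc n g) Q))))
           wlp-do-exit

  ⊢wlp-branch : ∀ g {e c} → e ⇒ c ∈GC g → (Q : Assn) → ⊢ c ∶⟨ wlp c Q ⟩⟨ Q ⟩
  ⊢wlp-branch [ e ⇒ c ]     here₁       = ⊢wlp c
  ⊢wlp-branch (e ⇒ c □ g)   here        = ⊢wlp c
  ⊢wlp-branch (e′ ⇒ c′ □ g) (there e⇒c) = ⊢wlp-branch g e⇒c

corollary8p1 : (c : Cmd) (f : Label) (P Q : Assn) →
    WellFormed c → okf c f → ⊨ c ∶⟨ P ⟩⟨ Q ⟩ → ⊢ c ∶⟨ P ⟩⟨ Q ⟩
corollary8p1 c f P Q _ _ ⊨c = strengthen (⊨⇒⊆wlp ⊨c) (⊢wlp c Q)
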